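{- Let $m>3$ and $n>3$, and let $G$ be the game board consisting of a cycle $C_m$ and a cycle $C_n$ joined at a single common vertex (so $G$ is the one-vertex union of the two cycles, drawn in the plane with the two cycles bounding two distinct cells). If $m$ and $n$ are both odd, then Player~2 has a winning strategy in the Game of Cycles on $G$.
   Context: The Game of Cycles: the board is a simple planar graph with a fixed planar embedding; its cells are the bounded faces of the embedding. Two players alternate turns; on a turn a player chooses a currently unmarked edge and marks it with an arrow (an orientation), subject to the sink-source rule: no move may create a sink (a vertex all of whose incident edges are marked and point toward it) or a source (a vertex all of whose incident edges are marked and point away from it). A cycle cell is a cell all of whose boundary edges are marked and oriented consistently, all clockwise or all counterclockwise around the cell. The first player to create a cycle cell wins; if no cycle cell is created, the player who makes the last possible legal move wins (a player with no legal move loses). A winning strategy for a player is a strategy guaranteeing that player a win regardless of the opponent's moves. -}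

module Defs where

open import Data.Nat using (ℕ; zero; suc; _+_; _*_; pred)
open import Data.Fin as Fin using (Fin; zero; suc)
open import Data.Fin.Properties using () renaming (_≟_ to _≟F_)
open import Data.Bool using (Bool; true; false; not)
open import Data.Maybe as Maybe using (Maybe; just; nothing)
open import Data.Sum using (_⊎_; inj₁; inj₂)
open import Data.Sum.Properties using (≡-dec)
open import Data.Product using (_×_; _,_; ∃)
open import Data.List using (List; map; _++_; allFin)
open import Data.List.Relation.Unary.All using (All)
open import Data.List.Relation.Unary.Any using (Any)
open import Data.Empty using (⊥)
open import Relation.Nullary using (¬_; yes; no)
open import Relation.Binary.PropositionalEquality using (_≡_)
open import Relation.Binary.Definitions using (DecidableEquality)

Odd : ℕ → Set
Odd m = ∃ λ k → m ≡ suc (2 * k)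

-- A game board: a (simple, plane) graph given by its vertices, its edges
-- (each with a reference orientation tail → head) and its cells (bounded
-- faces).  A cell is described by its boundary: the list of its boundary
-- edges, each tagged with a Bool saying whether the reference orientation
-- of the edge agrees (true) or disagrees (false) with a fixed traversal
-- direction of the boundary of the cell (say clockwise).

record Board : Set₁ where
  field
    Vtx      : Set
    Edg      : Set
    _≟E_     : DecidableEquality Edg
    tail     : Edg → Vtx
    head     : Edg → Vtx
    Cell     : Set
    boundary : Cell → List (Edg × Bool)

module Game (B : Board) where
  open Board B

  -- A position: each edge is unmarked (nothing) or marked with an arrow;
  -- just true = arrow from tail to head, just false = arrow from head to tail.
  Position : Set
  Position = Edg → Maybe Bool

  empty : Position
  empty _ = nothing

  mark : Position → Edg → Bool → Position
  mark p e d e' with e' ≟E e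
  ... | yes _ = just d
  ... | no  _ = p e'

  Incident : Edg → Vtx → Set
  Incident e v = (tail e ≡ v) ⊎ (head e ≡ v)

  PointsTo : Position → Edg → Vtx → Set
  PointsTo p e v = (p e ≡ just true × head e ≡ v) ⊎ (p e ≡ just false × tail e ≡ v)

  PointsFrom : Position → Edg → Vtx → Set
  PointsFrom p e v = (p e ≡ just true × tail e ≡ v) ⊎ (p e ≡ just false × head e ≡ v)

  Sink : Position → Vtx → Set
  Sink p v = ∀ e → Incident e v → PointsTo p e v

  Source : Position → Vtx → Set
  Source p v = ∀ e → Incident e v → PointsFrom p e v

  Legal : Position → Edg → Bool → Set
  Legal p e d = (p e ≡ nothing)
              × (∀ v → ¬ Sink (mark p e d) v × ¬ Source (mark p e d) v)

  CycleCell : Position → Cell → Set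
  CycleCell p c = All (λ { (e , s) → p e ≡ just s }) (boundary c)
                ⊎ All (λ { (e , s) → p e ≡ just (not s) }) (boundary c)

  HasCycleCell : Position → Set
  HasCycleCell p = ∃ λ c → CycleCell p c

  -- Winning positions for the player to move (Win) and for the player who
  -- just moved (Lose = the player to move loses), defined inductively;
  -- an inhabitant is precisely a winning strategy for the relevant player.
  -- A move that creates a cycle cell wins immediately; a player with no
  -- legal move loses.
  data Win  (p : Position) : Set
  data Lose (p : Position) : Set

  data Win p where
    win : (e : Edg) (d : Bool) → Legal p e d
        → HasCycleCell (mark p e d) ⊎ Lose (mark p e d)
        → Win p

  data Lose p where
    lose : (∀ e d → Legal p e d
              → ¬ HasCycleCell (mark p e d) × Win (mark p e d))
         → Lose p

  Player2Wins : Set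
  Player2Wins = Lose empty

open Game public using (Player2Wins)

-- The board: C_{k+1} and C_{l+1} glued at a single vertex.
-- Vertices: the common vertex (nothing), the k other vertices of the
-- first cycle (inj₁), the l other vertices of the second cycle (inj₂).
-- Edge i : Fin (suc k) of a cycle goes from vertex position i to
-- vertex position i+1 (mod k+1), where position 0 is the common vertex.

cycTail : ∀ {k} → Fin (suc k) → Maybe (Fin k)
cycTail zero    = nothing
cycTail (suc j) = just j

cycHead : ∀ {k} → Fin (suc k) → Maybe (Fin k)
cycHead {zero}  zero    = nothing
cycHead {suc k} zero    = just zero
cycHead {suc k} (suc i) = Maybe.map suc (cycHead i)

twoCyclesS : ℕ → ℕ → Board
twoCyclesS k l = record
  { Vtx      = Maybe (Fin k ⊎ Fin l)
  ; Edg      = Fin (suc k) ⊎ Fin (suc l)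
  ; _≟E_     = ≡-dec _≟F_ _≟F_
  ; tail     = λ { (inj₁ i) → Maybe.map inj₁ (cycTail i)
                 ; (inj₂ j) → Maybe.map inj₂ (cycTail j) }
  ; head     = λ { (inj₁ i) → Maybe.map inj₁ (cycHead i)
                 ; (inj₂ j) → Maybe.map inj₂ (cycHead j) }
  ; Cell     = Bool
  ; boundary = λ { true  → map (λ i → (inj₁ i , true)) (allFin (suc k))
                 ; false → map (λ j → (inj₂ j , true)) (allFin (suc l)) }
  }

-- the board for C_m and C_n joined at one vertex (meaningful for m, n ≥ 3)
twoCycles : ℕ → ℕ → Board
twoCycles m n = twoCyclesS (pred m) (pred n)

-- Player 2 plays the mirror strategy.  Reflecting each cycle in the line through the common
-- vertex (the hub) fixes exactly one edge, its middle edge, because the cycle is odd.  A move on a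
-- non-middle edge is answered on the mirror-image edge of the same cycle with the same sense of
-- rotation, and a move on one middle edge by a move on the other middle edge.  This keeps both
-- cycles symmetric, and symmetry makes every answer legal: a sink or source created by the answer
-- would be the mirror image of one created by the opponent, and in a symmetric cycle one hub edge
-- points into the hub and the other out of it.  The only danger is an answer that leaves a cycle
-- whose edges other than the middle one all point the same way round, so that the opponent closes
-- it through the middle edge.  In that case Player 2 marks the middle edge of the other cycle
-- instead; the threatened cycle then has exactly two open edges, and since the middle edge is at
-- distance at least 2 from the hub (m, n > 3), whichever of them the opponent marks must continue
-- the common direction, so Player 2 closes the cycle with the other.  As Player 2 always has an
-- answer, Player 1 eventually runs out of moves unless Player 2 closes a cycle first.
module Submission where

open import Defs
open import Data.Nat using (ℕ; zero; suc; _+_; _*_; _∸_; _<_; _≤_; z≤n; s≤s)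
import Data.Nat.Properties as ℕ
open import Data.Fin using (Fin; zero; suc; toℕ; fromℕ; fromℕ<; inject₁; lower₁; opposite)
open import Data.Fin.Properties
  using ( toℕ-injective; toℕ-inject₁; toℕ-fromℕ; toℕ-fromℕ<; toℕ<n; inject₁-injective; inject₁-lower₁
        ; suc-injective; opposite-prop; opposite-involutive; all? )
  renaming (_≟_ to _≟ᶠ_)
open import Data.Bool using (Bool; true; false; not)
open import Data.Bool.Properties using (not-¬; ¬-not) renaming (_≟_ to _≟ᵇ_)
open import Data.Maybe as Maybe using (Maybe; just; nothing; fromMaybe)
open import Data.Maybe.Properties using (just-injective; map-injective) renaming (≡-dec to ≡-decᵐ)
open import Data.Sum as Sum using (_⊎_; inj₁; inj₂; [_,_]′)
open import Data.Sum.Properties using (inj₁-injective; inj₂-injective)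
open import Data.Product using (_×_; _,_; ∃; ∃₂; Σ; proj₁; proj₂; map₂)
open import Data.List.Relation.Unary.All.Properties using (map⁺; map⁻; tabulate⁺; tabulate⁻)
open import Data.Empty using (⊥-elim)
open import Function using (_∘_)
open import Function.Definitions using (Injective)
open import Relation.Nullary using (¬_; Dec; yes; no)
open import Relation.Nullary.Decidable using (¬?; _→-dec_; _⊎-dec_)
open import Relation.Binary.PropositionalEquality
  using (_≡_; _≢_; refl; sym; trans; cong; cong₂; subst; _≗_; module ≡-Reasoning)

-- Markings of one cycle

-- The restriction of a position to the edges of one cycle of the board.
Marking : ℕ → Set
Marking n = Fin n → Maybe Bool

Agree : Maybe Bool → Maybe Bool → Set
Agree x y = ∀ {s t} → x ≡ just s → y ≡ just t → s ≡ t

agree-refl : ∀ {x} → Agree x x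
agree-refl ex ey = just-injective (trans (sym ex) ey)

agree-sym : ∀ {x y} → Agree x y → Agree y x
agree-sym a ex ey = sym (a ey ex)

-- Interior vertex j of C_{K+1} lies between the edges inject₁ j and suc j (see cycTail, cycHead).
EdgeAt : ∀ {K} → Fin K → Fin (suc K) → Set
EdgeAt j i = i ≡ inject₁ j ⊎ i ≡ suc j

edgeAt? : ∀ {K} (j : Fin K) i → Dec (EdgeAt j i)
edgeAt? j i = (i ≟ᶠ inject₁ j) ⊎-dec (i ≟ᶠ suc j)

suc≢inject₁ : ∀ {K} {j : Fin K} → suc j ≢ inject₁ j
suc≢inject₁ {j = j} e = ℕ.1+n≢n (trans (cong toℕ e) (toℕ-inject₁ j))

CoherentAt : ∀ {K} → Marking (suc K) → Fin K → Set
CoherentAt q j = Agree (q (inject₁ j)) (q (suc j))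

-- No interior vertex of the cycle is a sink or a source.
Coherent : ∀ {K} → Marking (suc K) → Set
Coherent q = ∀ j → CoherentAt q j

-- Both hub edges of the cycle point into the hub (b = true) or out of it (b = false).
HubEdges : ∀ {K} → Bool → Marking (suc K) → Set
HubEdges {K} b q = q zero ≡ just (not b) × q (fromℕ K) ≡ just b

HubSafe : ∀ {K L} → Marking (suc K) → Marking (suc L) → Set
HubSafe q r = ∀ b → ¬ (HubEdges b q × HubEdges b r)

record Safe {K L} (q : Marking (suc K)) (r : Marking (suc L)) : Set where
  field
    coherent₁ : Coherent q
    coherent₂ : Coherent r
    hubSafe   : HubSafe q r

safe-swap : ∀ {K L} {q : Marking (suc K)} {r : Marking (suc L)} → Safe q r → Safe r q
safe-swap s = record
  { coherent₁ = coherent₂ ; coherent₂ = coherent₁ ; hubSafe = λ b (h₂ , h₁) → hubSafe b (h₁ , h₂) }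
  where open Safe s

Filled : ∀ {n} → Marking n → Bool → Set
Filled q x = ∀ i → q i ≡ just x

Cyclic : ∀ {n} → Marking n → Set
Cyclic q = ∃ (Filled q)

cyclic? : ∀ {n} (q : Marking n) → Dec (Cyclic q)
cyclic? q with all? (λ i → ≡-decᵐ _≟ᵇ_ (q i) (just true)) | all? (λ i → ≡-decᵐ _≟ᵇ_ (q i) (just false))
... | yes f | _     = yes (true , f)
... | no _  | yes f = yes (false , f)
... | no ¬t | no ¬f = no λ { (true , f) → ¬t f ; (false , f) → ¬f f }

unmarked⇒¬cyclic : ∀ {n} {q : Marking n} {i} → q i ≡ nothing → ¬ Cyclic q
unmarked⇒¬cyclic qi (x , f) with () ← trans (sym (f _)) qi

FilledOff : ∀ {n} → Marking n → Fin n → Fin n → Bool → Set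
FilledOff q g h x = ∀ k → k ≢ g → k ≢ h → q k ≡ just x

filledOff? : ∀ {n} (q : Marking n) g h x → Dec (FilledOff q g h x)
filledOff? q g h x = all? λ k → ¬? (k ≟ᶠ g) →-dec (¬? (k ≟ᶠ h) →-dec ≡-decᵐ _≟ᵇ_ (q k) (just x))

Marked : ∀ {n} → Marking n → Fin n → Bool → Marking n → Set
Marked q j d r = r j ≡ just d × (∀ k → k ≢ j → r k ≡ q k)

Symmetric : ∀ {n} → Marking n → Set
Symmetric q = ∀ i → q (opposite i) ≡ q i

coherent-resp : ∀ {K} {q r : Marking (suc K)} → q ≗ r → Coherent q → Coherent r
coherent-resp q≗r c j ex ey = c j (trans (q≗r _) ex) (trans (q≗r _) ey)

symmetric-resp : ∀ {n} {q r : Marking n} → q ≗ r → Symmetric q → Symmetric r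
symmetric-resp q≗r s i = trans (sym (q≗r _)) (trans (s i) (q≗r i))

cyclic-resp : ∀ {n} {q r : Marking n} → q ≗ r → Cyclic q → Cyclic r
cyclic-resp q≗r (x , f) = x , λ i → trans (sym (q≗r i)) (f i)

filledOff-resp : ∀ {n} {q r : Marking n} {g h x} → q ≗ r → FilledOff q g h x → FilledOff r g h x
filledOff-resp q≗r f k k≢g k≢h = trans (sym (q≗r k)) (f k k≢g k≢h)

marked-resp : ∀ {n} {q q′ r : Marking n} {j d} → q ≗ q′ → Marked q′ j d r → Marked q j d r
marked-resp q≗q′ (rj , same) = rj , λ k k≢j → trans (same k k≢j) (sym (q≗q′ k))

isOpen : Maybe Bool → ℕ
isOpen = Maybe.maybe′ (λ _ → 0) 1

openEdges : ∀ {n} → Marking n → ℕ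
openEdges {zero}  q = 0
openEdges {suc n} q = isOpen (q zero) + openEdges (q ∘ suc)

openEdges-resp : ∀ {n} {q r : Marking n} → q ≗ r → openEdges q ≡ openEdges r
openEdges-resp {zero}  q≗r = refl
openEdges-resp {suc n} q≗r = cong₂ _+_ (cong isOpen (q≗r zero)) (openEdges-resp (q≗r ∘ suc))

openEdges-mark : ∀ {n} {q r : Marking n} {i d} → q i ≡ nothing → Marked q i d r → openEdges r < openEdges q
openEdges-mark {suc n} {i = zero} qi (ri , same) rewrite qi | ri =
  s≤s (ℕ.≤-reflexive (openEdges-resp λ k → same (suc k) λ ()))
openEdges-mark {suc n} {q} {i = suc i} qi (ri , same) rewrite same zero (λ ()) =
  ℕ.+-monoʳ-< (isOpen (q zero)) (openEdges-mark qi (ri , λ k k≢i → same (suc k) (k≢i ∘ suc-injective)))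

-- Coherence and symmetry

agree-at : ∀ {K} {q : Marking (suc K)} {j i k} → Coherent q → EdgeAt j i → EdgeAt j k → Agree (q i) (q k)
agree-at {q = q} c (inj₁ refl) (inj₁ refl) = agree-refl {q _}
agree-at         c (inj₁ refl) (inj₂ refl) = c _
agree-at         c (inj₂ refl) (inj₁ refl) = agree-sym (c _)
agree-at {q = q} c (inj₂ refl) (inj₂ refl) = agree-refl {q _}

filled⇒coherent : ∀ {K} {q : Marking (suc K)} {x} → Filled q x → Coherent q
filled⇒coherent f j ex ey = just-injective (trans (sym ex) (trans (f _) (trans (sym (f _)) ey)))

coherentAt-off : ∀ {K} {q r : Marking (suc K)} {i j} → (∀ k → k ≢ i → r k ≡ q k) → ¬ EdgeAt j i →
                 CoherentAt q j → CoherentAt r j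
coherentAt-off same ¬at c ex ey =
  c (trans (sym (same _ (¬at ∘ inj₁ ∘ sym))) ex) (trans (sym (same _ (¬at ∘ inj₂ ∘ sym))) ey)

coherent-mark : ∀ {K} {q r : Marking (suc K)} {i d} → Coherent q → Marked q i d r →
                (∀ {j k} → EdgeAt j i → EdgeAt j k → k ≢ i → Agree (just d) (q k)) → Coherent r
coherent-mark {i = i} cq (ri , same) agrees j with edgeAt? j i
... | no ¬at          = coherentAt-off same ¬at (cq j)
... | yes (inj₁ refl) = λ ex ey → trans (just-injective (trans (sym ex) ri))
  (agrees (inj₁ refl) (inj₂ refl) suc≢inject₁ refl (trans (sym (same _ suc≢inject₁)) ey))
... | yes (inj₂ refl) = λ ex ey → sym (trans (just-injective (trans (sym ey) ri))
  (agrees (inj₂ refl) (inj₁ refl) (suc≢inject₁ ∘ sym) refl (trans (sym (same _ (suc≢inject₁ ∘ sym))) ex)))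

opposite-inject₁ : ∀ {K} (j : Fin K) → opposite (inject₁ j) ≡ suc (opposite j)
opposite-inject₁ {suc K} zero    = refl
opposite-inject₁ {suc K} (suc j) = cong inject₁ (opposite-inject₁ j)

opposite-swap : ∀ {n} {i k : Fin n} → opposite k ≡ i → k ≡ opposite i
opposite-swap {k = k} e = trans (sym (opposite-involutive k)) (cong opposite e)

edgeAt-opposite : ∀ {K} {j : Fin K} {i} → EdgeAt (opposite j) i → EdgeAt j (opposite i)
edgeAt-opposite {j = j} (inj₁ refl) = inj₂ (trans (opposite-inject₁ (opposite j)) (cong suc (opposite-involutive j)))
edgeAt-opposite {j = j} (inj₂ refl) = inj₁ (cong inject₁ (opposite-involutive j))

coherentAt-mirror : ∀ {K} {q : Marking (suc K)} {j} → Symmetric q → CoherentAt q (opposite j) → CoherentAt q j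
coherentAt-mirror {q = q} {j} sq c ex ey =
  sym (c (trans (sq (suc j)) ey) (trans (cong q (sym (opposite-inject₁ j))) (trans (sq (inject₁ j)) ex)))

symmetric-update : ∀ {n} {q r : Marking n} {i} → Symmetric q →
                   (∀ k → k ≢ i → k ≢ opposite i → r k ≡ q k) → r (opposite i) ≡ r i → Symmetric r
symmetric-update {r = r} {i} sq same ri k with k ≟ᶠ i | k ≟ᶠ opposite i
... | yes refl | _        = ri
... | no _     | yes refl = trans (cong r (opposite-involutive i)) (sym ri)
... | no k≢i   | no k≢oi  =
  trans (same (opposite k) (k≢oi ∘ opposite-swap) (λ e → k≢i (trans (opposite-swap e) (opposite-involutive i))))
        (trans (sq k) (sym (same k k≢i k≢oi)))

symmetric⇒¬hubEdges : ∀ {K} {q : Marking (suc K)} {b} → Symmetric q → ¬ HubEdges b q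
symmetric⇒¬hubEdges sq (into , out) = not-¬ refl (just-injective (trans (sym out) (trans (sq zero) into)))

symmetric₁⇒safe : ∀ {K L} {q : Marking (suc K)} {r : Marking (suc L)} →
                   Symmetric q → Coherent q → Coherent r → Safe q r
symmetric₁⇒safe sq cq cr = record
  { coherent₁ = cq ; coherent₂ = cr ; hubSafe = λ b (hq , _) → symmetric⇒¬hubEdges sq hq }

symmetric₂⇒safe : ∀ {K L} {q : Marking (suc K)} {r : Marking (suc L)} →
                   Symmetric r → Coherent q → Coherent r → Safe q r
symmetric₂⇒safe sr cq cr = safe-swap (symmetric₁⇒safe sr cr cq)

-- Odd cycles

-- An odd cycle C_{K+1} of length at least 5, seen through its reflection opposite, which fixes the hub.
record Axis (K : ℕ) : Set where
  field
    mid          : Fin (suc K)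
    mid-fixed    : opposite mid ≡ mid
    fixed⇒mid    : ∀ i → opposite i ≡ i → i ≡ mid
    vertex-moved : ∀ (j : Fin K) → opposite j ≢ j
    near-hub≢mid : ∀ i → toℕ i < 2 → i ≢ mid

module AxisProperties {K} (A : Axis (suc K)) where
  open Axis A

  0<2 : 0 < 2
  0<2 = s≤s z≤n

  1<2 : 1 < 2
  1<2 = s≤s (s≤s z≤n)

  moved : ∀ {i} → i ≢ mid → i ≢ opposite i
  moved i≢mid e = i≢mid (fixed⇒mid _ (sym e))

  opposite≢mid : ∀ {i} → i ≢ mid → opposite i ≢ mid
  opposite≢mid i≢mid e = i≢mid (trans (opposite-swap e) mid-fixed)

  opposite-near-hub≢mid : ∀ i → toℕ i < 2 → opposite i ≢ mid
  opposite-near-hub≢mid i i<2 = opposite≢mid (near-hub≢mid i i<2)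

  mirror-vertex-off : ∀ {i} j → i ≢ opposite i → EdgeAt j i → ¬ EdgeAt (opposite j) i
  mirror-vertex-off j i≢oi at at′ with at | edgeAt-opposite {j = j} at′
  ... | inj₁ refl | inj₁ e = i≢oi (sym e)
  ... | inj₁ refl | inj₂ e = vertex-moved j (suc-injective (trans (sym (opposite-inject₁ j)) e))
  ... | inj₂ refl | inj₁ e = vertex-moved j (inject₁-injective e)
  ... | inj₂ refl | inj₂ e = i≢oi (sym e)

  -- A vertex next to the newly marked edge i is the mirror image of a vertex away from it.
  coherent-mirror : ∀ {q r : Marking (suc (suc K))} {i} → i ≢ opposite i → Coherent q → Symmetric r →
                    (∀ k → k ≢ i → r k ≡ q k) → Coherent r
  coherent-mirror {i = i} i≢oi cq sr same j with edgeAt? j i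
  ... | no ¬at = coherentAt-off same ¬at (cq j)
  ... | yes at = coherentAt-mirror sr (coherentAt-off same (mirror-vertex-off j i≢oi at) (cq (opposite j)))

  mid-as-suc : Σ (Fin (suc K)) λ j → suc j ≡ mid
  mid-as-suc with mid | near-hub≢mid zero 0<2
  ... | zero  | zero≢mid = ⊥-elim (zero≢mid refl)
  ... | suc j | _        = j , refl

  pre-mid : Fin (suc K)
  pre-mid = proj₁ mid-as-suc

  post-mid : ∀ {j} → mid ≡ inject₁ j → opposite pre-mid ≡ j
  post-mid e = inject₁-injective (trans (trans (cong opposite (proj₂ mid-as-suc)) mid-fixed) e)

  mid-neighbour : ∀ {q : Marking (suc (suc K))} {j k} → Symmetric q → EdgeAt j mid → EdgeAt j k → k ≢ mid →
                  q k ≡ q (inject₁ pre-mid)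
  mid-neighbour     sq (inj₁ e) (inj₁ refl) k≢mid = ⊥-elim (k≢mid (sym e))
  mid-neighbour {q} sq (inj₁ e) (inj₂ refl) _ with refl ← post-mid e =
    trans (cong q (sym (opposite-inject₁ pre-mid))) (sq (inject₁ pre-mid))
  mid-neighbour {q} sq (inj₂ e) (inj₁ refl) _ =
    cong (q ∘ inject₁) (suc-injective (trans (sym e) (sym (proj₂ mid-as-suc))))
  mid-neighbour     sq (inj₂ e) (inj₂ refl) k≢mid = ⊥-elim (k≢mid (sym e))

  symmetric-mark-mid : ∀ {q r : Marking (suc (suc K))} {d} → Symmetric q → Marked q mid d r → Symmetric r
  symmetric-mark-mid {r = r} sq (_ , same) = symmetric-update sq (λ k k≢mid _ → same k k≢mid) (cong r mid-fixed)

  -- In a symmetric marking both neighbours of mid carry this colour, if they are marked.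
  midColour : Marking (suc (suc K)) → Bool
  midColour q = fromMaybe true (q (inject₁ pre-mid))

  coherent-mark-mid : ∀ {q r : Marking (suc (suc K))} → Coherent q → Symmetric q → Marked q mid (midColour q) r →
                      Coherent r
  coherent-mark-mid {q} cq sq m = coherent-mark cq m λ at-mid at k≢mid ex ey →
    agree-fromMaybe (q (inject₁ pre-mid)) ex (trans (sym (mid-neighbour sq at-mid at k≢mid)) ey)
    where
    agree-fromMaybe : ∀ y → Agree (just (fromMaybe true y)) y
    agree-fromMaybe (just t) ex refl = sym (just-injective ex)

  -- A hub edge has a single neighbour, which is not mid; an inner edge has two, one of them not h′.
  neighbour : ∀ {h h′} → h ≢ h′ → h ≡ mid ⊎ h′ ≡ mid →
              ∃₂ λ j k → EdgeAt j h × EdgeAt j k × k ≢ h × k ≢ h′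
  neighbour {zero} {h′} _ at-mid =
    zero , suc zero , inj₁ refl , inj₂ refl , (λ ()) , near-hub≢mid (suc zero) 1<2 ∘ (λ e → trans e h′≡mid)
    where
    h′≡mid : h′ ≡ mid
    h′≡mid = [ ⊥-elim ∘ near-hub≢mid zero 0<2 , (λ e → e) ]′ at-mid
  neighbour {suc j₀} {h′} _ at-mid with inject₁ j₀ ≟ᶠ h′
  ... | no ≢h′   = j₀ , inject₁ j₀ , inj₂ refl , inj₁ refl , suc≢inject₁ ∘ sym , ≢h′
  ... | yes refl =
    j₁ , suc j₁ , inj₁ (sym inject₁j₁) , inj₂ refl , suc≢inject₁ ∘ (λ e → trans e (sym inject₁j₁)) , suc-j₁≢
    where
    not-last : suc K ≢ toℕ (suc j₀)
    not-last e with toℕ-injective {j = fromℕ K} (trans (sym (ℕ.suc-injective e)) (sym (toℕ-fromℕ K)))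
    ... | refl = [ opposite-near-hub≢mid zero 0<2 , opposite-near-hub≢mid (suc zero) 1<2 ]′ at-mid
    j₁ : Fin (suc K)
    j₁ = lower₁ (suc j₀) not-last
    inject₁j₁ : inject₁ j₁ ≡ suc j₀
    inject₁j₁ = inject₁-lower₁ (suc j₀) not-last
    suc-j₁≢ : suc j₁ ≢ inject₁ j₀
    suc-j₁≢ e = ℕ.m+1+n≢n 1 (begin
      suc (suc (toℕ j₀))      ≡⟨ cong (suc ∘ toℕ) inject₁j₁ ⟨
      suc (toℕ (inject₁ j₁))  ≡⟨ cong suc (toℕ-inject₁ j₁) ⟩
      toℕ (suc j₁)            ≡⟨ cong toℕ e ⟩
      toℕ (inject₁ j₀)        ≡⟨ toℕ-inject₁ j₀ ⟩
      toℕ j₀                  ∎)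
      where open ≡-Reasoning

  closing-colour : ∀ {r : Marking (suc (suc K))} {h h′ d x} → Coherent r → r h ≡ just d →
                   FilledOff r h h′ x → h ≢ h′ → h ≡ mid ⊎ h′ ≡ mid → d ≡ x
  closing-colour cr rh filled h≢h′ at-mid with neighbour h≢h′ at-mid
  ... | j , k , at-h , at-k , k≢h , k≢h′ = agree-at cr at-h at-k rh (filled k k≢h k≢h′)

oddAxis : ∀ c → 2 ≤ c → Axis (2 * c)
oddAxis c 2≤c = record
  { mid          = centre
  ; mid-fixed    = toℕ-injective (begin
      toℕ (opposite centre)  ≡⟨ opposite-prop centre ⟩
      2 * c ∸ toℕ centre     ≡⟨ cong (2 * c ∸_) toℕ-centre ⟩
      2 * c ∸ c              ≡⟨ ℕ.m+n∸m≡n c (c + 0) ⟩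
      c + 0                  ≡⟨ ℕ.+-identityʳ c ⟩
      c                      ≡⟨ toℕ-centre ⟨
      toℕ centre             ∎)
  ; fixed⇒mid    = fixed⇒centre
  ; vertex-moved = vertex-unfixed
  ; near-hub≢mid = λ i i<2 e → ℕ.<⇒≱ (subst (_< 2) (trans (cong toℕ e) toℕ-centre) i<2) 2≤c
  }
  where
  open ≡-Reasoning

  double : ∀ t → t + t ≡ 2 * t
  double t = cong (t +_) (sym (ℕ.+-identityʳ t))

  centre : Fin (suc (2 * c))
  centre = fromℕ< (s≤s (ℕ.m≤m+n c (c + 0)))

  toℕ-centre : toℕ centre ≡ c
  toℕ-centre = toℕ-fromℕ< _

  fixed⇒centre : ∀ i → opposite i ≡ i → i ≡ centre
  fixed⇒centre i e = toℕ-injective (trans (ℕ.*-cancelˡ-≡ (toℕ i) c 2 (begin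
    2 * toℕ i                ≡⟨ double (toℕ i) ⟨
    toℕ i + toℕ i            ≡⟨ cong (_+ toℕ i) (trans (sym (cong toℕ e)) (opposite-prop i)) ⟩
    (2 * c ∸ toℕ i) + toℕ i  ≡⟨ ℕ.m∸n+n≡m (ℕ.≤-pred (toℕ<n i)) ⟩
    2 * c                    ∎)) (sym toℕ-centre))

  vertex-unfixed : ∀ (j : Fin (2 * c)) → opposite j ≢ j
  vertex-unfixed j e = ℕ.even≢odd c (toℕ j) (begin
    2 * c                                ≡⟨ ℕ.m∸n+n≡m (toℕ<n j) ⟨
    (2 * c ∸ suc (toℕ j)) + suc (toℕ j)  ≡⟨ cong (_+ suc (toℕ j)) (trans (sym (opposite-prop j)) (cong toℕ e)) ⟩
    toℕ j + suc (toℕ j)                  ≡⟨ ℕ.+-suc (toℕ j) (toℕ j) ⟩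
    suc (toℕ j + toℕ j)                  ≡⟨ cong suc (double (toℕ j)) ⟩
    suc (2 * toℕ j)                      ∎)

-- The strategy of Player 2

open Axis using (mid; near-hub≢mid)

-- Marking mid does not close the cycle.
Unthreatened : ∀ {K} → Axis (suc K) → Marking (suc (suc K)) → Set
Unthreatened A q = ∀ x → ¬ FilledOff q (mid A) (mid A) x

module _ {K₁ K₂ : ℕ} (A₁ : Axis (suc K₁)) (A₂ : Axis (suc K₂))
         (q₁ : Marking (suc (suc K₁))) (q₂ : Marking (suc (suc K₂))) where

  data Mids : Set where
    open-mids   : q₁ (mid A₁) ≡ nothing → q₂ (mid A₂) ≡ nothing →
                  Unthreatened A₁ q₁ → Unthreatened A₂ q₂ → Mids
    closed-mids : q₁ (mid A₁) ≢ nothing → q₂ (mid A₂) ≢ nothing → Mids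

  record Balanced : Set where
    field
      symmetric₁ : Symmetric q₁
      symmetric₂ : Symmetric q₂
      mids       : Mids

  -- Whichever open edge of the first cycle is marked, marking the other one closes it.
  record Trap : Set where
    field
      gap         : Fin (suc (suc K₁))
      colour      : Bool
      gap≢mid     : gap ≢ mid A₁
      gap-open    : q₁ gap ≡ nothing
      mid-open    : q₁ (mid A₁) ≡ nothing
      rest        : FilledOff q₁ gap (mid A₁) colour
      symmetric₂  : Symmetric q₂
      mid-closed₂ : q₂ (mid A₂) ≢ nothing

open Trap using (gap; colour; gap≢mid; gap-open; mid-open; rest; mid-closed₂)

Invariant : ∀ {K₁ K₂} → Axis (suc K₁) → Axis (suc K₂) →
            Marking (suc (suc K₁)) → Marking (suc (suc K₂)) → Set
Invariant A₁ A₂ q₁ q₂ = Balanced A₁ A₂ q₁ q₂ ⊎ Trap A₁ A₂ q₁ q₂ ⊎ Trap A₂ A₁ q₂ q₁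

Outcome : ∀ {K₁ K₂} → Axis (suc K₁) → Axis (suc K₂) →
          Marking (suc (suc K₁)) → Marking (suc (suc K₂)) → Set
Outcome A₁ A₂ r₁ r₂ = Safe r₁ r₂ × ((Cyclic r₁ ⊎ Cyclic r₂) ⊎ Invariant A₁ A₂ r₁ r₂)

-- Player 2 marks edge j of one cycle with d; the result is stated for every marking pair
-- pointwise equal to the resulting one.
data Reply {K₁ K₂} (A₁ : Axis (suc K₁)) (A₂ : Axis (suc K₂))
           (q₁ : Marking (suc (suc K₁))) (q₂ : Marking (suc (suc K₂))) : Set where
  first  : ∀ j d → q₁ j ≡ nothing →
           (∀ {r₁ r₂} → Marked q₁ j d r₁ → r₂ ≗ q₂ → Outcome A₁ A₂ r₁ r₂) → Reply A₁ A₂ q₁ q₂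
  second : ∀ j d → q₂ j ≡ nothing →
           (∀ {r₁ r₂} → r₁ ≗ q₁ → Marked q₂ j d r₂ → Outcome A₁ A₂ r₁ r₂) → Reply A₁ A₂ q₁ q₂

module _ {K₁ K₂} {A₁ : Axis (suc K₁)} {A₂ : Axis (suc K₂)} where

  mids-swap : ∀ {q₁ q₂} → Mids A₁ A₂ q₁ q₂ → Mids A₂ A₁ q₂ q₁
  mids-swap (open-mids m₁ m₂ u₁ u₂) = open-mids m₂ m₁ u₂ u₁
  mids-swap (closed-mids m₁ m₂)     = closed-mids m₂ m₁

  invariant-swap : ∀ {q₁ q₂} → Invariant A₁ A₂ q₁ q₂ → Invariant A₂ A₁ q₂ q₁
  invariant-swap (inj₁ b)        =
    inj₁ record { symmetric₁ = symmetric₂ ; symmetric₂ = symmetric₁ ; mids = mids-swap mids }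
    where open Balanced b
  invariant-swap (inj₂ (inj₁ t)) = inj₂ (inj₂ t)
  invariant-swap (inj₂ (inj₂ t)) = inj₂ (inj₁ t)

  outcome-swap : ∀ {r₁ r₂} → Outcome A₁ A₂ r₁ r₂ → Outcome A₂ A₁ r₂ r₁
  outcome-swap (safe , inj₁ (inj₁ c)) = safe-swap safe , inj₁ (inj₂ c)
  outcome-swap (safe , inj₁ (inj₂ c)) = safe-swap safe , inj₁ (inj₁ c)
  outcome-swap (safe , inj₂ i)        = safe-swap safe , inj₂ (invariant-swap i)

  reply-swap : ∀ {q₁ q₂} → Reply A₁ A₂ q₁ q₂ → Reply A₂ A₁ q₂ q₁
  reply-swap (first j d qj k)  = second j d qj λ r₂≗ m → outcome-swap (k m r₂≗)
  reply-swap (second j d qj k) = first j d qj λ m r₁≗ → outcome-swap (k r₁≗ m)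

just≢nothing : ∀ {A : Set} {a : A} → just a ≢ nothing
just≢nothing ()

marked≢nothing : ∀ {n} {q r : Marking n} {j d} → Marked q j d r → r j ≢ nothing
marked≢nothing (rj , _) e = just≢nothing (trans (sym rj) e)

module Responses {K₁ K₂} (A₁ : Axis (suc K₁)) (A₂ : Axis (suc K₂)) where
  private
    module P₁ = AxisProperties A₁
    module P₂ = AxisProperties A₂

  Answerable : Marking (suc (suc K₁)) → Marking (suc (suc K₂)) → Set
  Answerable q₁ q₂ = ∀ {q₁′ i d} → Coherent q₂ → q₁ i ≡ nothing → Marked q₁ i d q₁′ → Coherent q₁′ →
                     ¬ Cyclic q₁′ × Reply A₁ A₂ q₁′ q₂

  mirror-open : ∀ {q₁ q₁′} {i d} → Symmetric q₁ → i ≢ mid A₁ → q₁ i ≡ nothing → Marked q₁ i d q₁′ →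
                q₁′ (opposite i) ≡ nothing
  mirror-open {i = i} sq₁ i≢mid qi (_ , same) = trans (same _ (P₁.moved i≢mid ∘ sym)) (trans (sq₁ i) qi)

  mirror-reply : ∀ {q₁ q₁′ q₂} {i d} → Symmetric q₁ → i ≢ mid A₁ → q₁ i ≡ nothing → Marked q₁ i d q₁′ →
                 Coherent q₁′ → Coherent q₂ →
                 (∀ {r₁ r₂} → Marked q₁′ (opposite i) d r₁ → r₂ ≗ q₂ → Symmetric r₁ →
                   r₁ (mid A₁) ≡ q₁ (mid A₁) → Invariant A₁ A₂ r₁ r₂) →
                 Reply A₁ A₂ q₁′ q₂
  mirror-reply {q₁} {q₁′} {q₂} {i} {d} sq₁ i≢mid qi m c₁′ c₂ continue =
    first (opposite i) d (mirror-open sq₁ i≢mid qi m) outcome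
    where
    oi≢mid : opposite i ≢ mid A₁
    oi≢mid = P₁.opposite≢mid i≢mid
    outcome : ∀ {r₁ r₂} → Marked q₁′ (opposite i) d r₁ → r₂ ≗ q₂ → Outcome A₁ A₂ r₁ r₂
    outcome {r₁} (r₁oi , same′) r₂≗ =
      symmetric₁⇒safe sr₁ (P₁.coherent-mirror (P₁.moved oi≢mid) c₁′ sr₁ same′) (coherent-resp (sym ∘ r₂≗) c₂) ,
      inj₂ (continue (r₁oi , same′) r₂≗ sr₁ (trans (same′ _ (oi≢mid ∘ sym)) (proj₂ m _ (i≢mid ∘ sym))))
      where
      sr₁ : Symmetric r₁
      sr₁ = symmetric-update sq₁ (λ k k≢i k≢oi → trans (same′ k k≢oi) (proj₂ m k k≢i))
                             (trans r₁oi (sym (trans (same′ i (P₁.moved i≢mid)) (proj₁ m))))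

  mid-reply : ∀ {q₁′ q₂} → Coherent q₁′ → Coherent q₂ → Symmetric q₂ → q₂ (mid A₂) ≡ nothing →
              (∀ {r₁ r₂} → r₁ ≗ q₁′ → Marked q₂ (mid A₂) (P₂.midColour q₂) r₂ → Symmetric r₂ →
                Invariant A₁ A₂ r₁ r₂) →
              Reply A₁ A₂ q₁′ q₂
  mid-reply {q₂ = q₂} c₁′ c₂ sq₂ m₂ continue = second (mid A₂) (P₂.midColour q₂) m₂ λ r₁≗ m →
    let sr₂ = P₂.symmetric-mark-mid sq₂ m
    in symmetric₂⇒safe sr₂ (coherent-resp (sym ∘ r₁≗) c₁′) (P₂.coherent-mark-mid c₂ sq₂ m) ,
       inj₂ (continue r₁≗ m sr₂)

  close-trap : ∀ {q₁ q₁′ q₂} {h h′ x d} → h ≢ h′ → h ≡ mid A₁ ⊎ h′ ≡ mid A₁ → q₁ h′ ≡ nothing →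
               FilledOff q₁ h h′ x → Marked q₁ h d q₁′ → Coherent q₁′ → Coherent q₂ → Symmetric q₂ →
               ¬ Cyclic q₁′ × Reply A₁ A₂ q₁′ q₂
  close-trap {q₁} {q₁′} {q₂} {h} {h′} {x} {d} h≢h′ at-mid qh′ filled (q₁′h , same) c₁′ c₂ sq₂ =
    unmarked⇒¬cyclic q₁′h′ , first h′ x q₁′h′ outcome
    where
    q₁′h′ : q₁′ h′ ≡ nothing
    q₁′h′ = trans (same h′ (h≢h′ ∘ sym)) qh′
    filled′ : FilledOff q₁′ h h′ x
    filled′ k k≢h k≢h′ = trans (same k k≢h) (filled k k≢h k≢h′)
    d≡x : d ≡ x
    d≡x = P₁.closing-colour c₁′ q₁′h filled′ h≢h′ at-mid
    closed : ∀ {r₁} → Marked q₁′ h′ x r₁ → Filled r₁ x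
    closed (rh′ , same′) k with k ≟ᶠ h′ | k ≟ᶠ h
    ... | yes refl | _        = rh′
    ... | no k≢h′  | yes refl = trans (same′ k k≢h′) (trans q₁′h (cong just d≡x))
    ... | no k≢h′  | no k≢h   = trans (same′ k k≢h′) (filled′ k k≢h k≢h′)
    outcome : ∀ {r₁ r₂} → Marked q₁′ h′ x r₁ → r₂ ≗ q₂ → Outcome A₁ A₂ r₁ r₂
    outcome m r₂≗ =
      symmetric₂⇒safe (symmetric-resp (sym ∘ r₂≗) sq₂) (filled⇒coherent (closed m)) (coherent-resp (sym ∘ r₂≗) c₂) ,
      inj₁ (inj₁ (x , closed m))

  respond-trap : ∀ {q₁ q₂} → Trap A₁ A₂ q₁ q₂ → Answerable q₁ q₂
  respond-trap t {i = i} c₂ qi m c₁′ with i ≟ᶠ gap t | i ≟ᶠ mid A₁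
  ... | yes refl | _        =
    close-trap (gap≢mid t) (inj₂ refl) (mid-open t) (rest t) m c₁′ c₂ (Trap.symmetric₂ t)
  ... | no _     | yes refl =
    close-trap (gap≢mid t ∘ sym) (inj₁ refl) (gap-open t) (λ k k≢mid k≢gap → rest t k k≢gap k≢mid)
               m c₁′ c₂ (Trap.symmetric₂ t)
  ... | no i≢gap | no i≢mid = ⊥-elim (just≢nothing (trans (sym (rest t i i≢gap i≢mid)) qi))

  respond-mid : ∀ {q₁ q₁′ q₂} {d} → Symmetric q₁ → Symmetric q₂ → q₂ (mid A₂) ≡ nothing → Unthreatened A₁ q₁ →
                Coherent q₂ → Marked q₁ (mid A₁) d q₁′ → Coherent q₁′ → ¬ Cyclic q₁′ × Reply A₁ A₂ q₁′ q₂
  respond-mid sq₁ sq₂ m₂ u₁ c₂ m c₁′ =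
    (λ (x , f) → u₁ x λ k k≢mid _ → trans (sym (proj₂ m k k≢mid)) (f k)) ,
    mid-reply c₁′ c₂ sq₂ m₂ λ r₁≗ m′ sr₂ → inj₁ record
      { symmetric₁ = symmetric-resp (sym ∘ r₁≗) (P₁.symmetric-mark-mid sq₁ m)
      ; symmetric₂ = sr₂
      ; mids       = closed-mids (marked≢nothing m ∘ trans (sym (r₁≗ _))) (marked≢nothing m′) }

  respond-off-mid : ∀ {q₁ q₁′ q₂} {i d} → Balanced A₁ A₂ q₁ q₂ → i ≢ mid A₁ → Coherent q₂ → q₁ i ≡ nothing →
                    Marked q₁ i d q₁′ → Coherent q₁′ → ¬ Cyclic q₁′ × Reply A₁ A₂ q₁′ q₂
  respond-off-mid {q₁} {q₁′} {q₂} {i} {d} b i≢mid c₂ qi m c₁′ =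
    unmarked⇒¬cyclic (mirror-open sq₁ i≢mid qi m) , reply mids (filledOff? q₁′ (opposite i) (mid A₁) d)
    where
    open Balanced b renaming (symmetric₁ to sq₁; symmetric₂ to sq₂)
    -- If mirroring would leave the first cycle threatened, a trap is set instead.
    reply : Mids A₁ A₂ q₁ q₂ → Dec (FilledOff q₁′ (opposite i) (mid A₁) d) → Reply A₁ A₂ q₁′ q₂
    reply (open-mids m₁ m₂ u₁ u₂) (yes threat) = mid-reply c₁′ c₂ sq₂ m₂ λ r₁≗ m′ sr₂ → inj₂ (inj₁ record
      { gap         = opposite i
      ; colour      = d
      ; gap≢mid     = P₁.opposite≢mid i≢mid
      ; gap-open    = trans (r₁≗ _) (mirror-open sq₁ i≢mid qi m)
      ; mid-open    = trans (r₁≗ _) (trans (proj₂ m _ (i≢mid ∘ sym)) m₁)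
      ; rest        = filledOff-resp (sym ∘ r₁≗) threat
      ; symmetric₂  = sr₂
      ; mid-closed₂ = marked≢nothing m′ })
    reply (open-mids m₁ m₂ u₁ u₂) (no ¬threat) = mirror-reply sq₁ i≢mid qi m c₁′ c₂ λ m′ r₂≗ sr₁ r₁mid →
      inj₁ record
        { symmetric₁ = sr₁
        ; symmetric₂ = symmetric-resp (sym ∘ r₂≗) sq₂
        ; mids       = open-mids (trans r₁mid m₁) (trans (r₂≗ _) m₂) (unthreatened m′)
                                 (λ x f → u₂ x (filledOff-resp r₂≗ f)) }
      where
      unthreatened : ∀ {r₁} → Marked q₁′ (opposite i) d r₁ → Unthreatened A₁ r₁
      unthreatened (r₁oi , same) x f =
        ¬threat λ k k≢oi k≢mid → trans (sym (same k k≢oi)) (trans (f k k≢mid k≢mid) (cong just x≡d))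
        where
        x≡d : x ≡ d
        x≡d = just-injective (trans (sym (f _ (P₁.opposite≢mid i≢mid) (P₁.opposite≢mid i≢mid))) r₁oi)
    reply (closed-mids m₁ m₂) _ = mirror-reply sq₁ i≢mid qi m c₁′ c₂ λ m′ r₂≗ sr₁ r₁mid →
      inj₁ record
        { symmetric₁ = sr₁
        ; symmetric₂ = symmetric-resp (sym ∘ r₂≗) sq₂
        ; mids       = closed-mids (m₁ ∘ trans (sym r₁mid)) (m₂ ∘ trans (sym (r₂≗ _))) }

  respond-balanced : ∀ {q₁ q₂} → Balanced A₁ A₂ q₁ q₂ → Answerable q₁ q₂
  respond-balanced b {i = i} c₂ qi m c₁′ with i ≟ᶠ mid A₁ | Balanced.mids b
  ... | yes refl | open-mids _ m₂ u₁ _ = respond-mid (Balanced.symmetric₁ b) (Balanced.symmetric₂ b) m₂ u₁ c₂ m c₁′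
  ... | yes refl | closed-mids m₁ _    = ⊥-elim (m₁ qi)
  ... | no i≢mid | _                   = respond-off-mid b i≢mid c₂ qi m c₁′

  respond-beside-trap : ∀ {q₁ q₂} → Trap A₂ A₁ q₂ q₁ → Answerable q₁ q₂
  respond-beside-trap {q₁} t {i = i} c₂ qi m c₁′ =
    unmarked⇒¬cyclic (mirror-open (Trap.symmetric₂ t) i≢mid qi m) ,
    mirror-reply (Trap.symmetric₂ t) i≢mid qi m c₁′ c₂ λ m′ r₂≗ sr₁ r₁mid → inj₂ (inj₂ record
      { gap         = gap t
      ; colour      = colour t
      ; gap≢mid     = gap≢mid t
      ; gap-open    = trans (r₂≗ _) (gap-open t)
      ; mid-open    = trans (r₂≗ _) (mid-open t)
      ; rest        = filledOff-resp (sym ∘ r₂≗) (rest t)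
      ; symmetric₂  = sr₁
      ; mid-closed₂ = mid-closed₂ t ∘ trans (sym r₁mid) })
    where
    i≢mid : i ≢ mid A₁
    i≢mid e = mid-closed₂ t (trans (cong q₁ (sym e)) qi)

  respond : ∀ {q₁ q₂} → Invariant A₁ A₂ q₁ q₂ → Answerable q₁ q₂
  respond (inj₁ b)        = respond-balanced b
  respond (inj₂ (inj₁ t)) = respond-trap t
  respond (inj₂ (inj₂ t)) = respond-beside-trap t

-- Sinks and sources on the board

-- An edge with label x, tail t and head h points into v (b = true) or out of v (b = false),
-- exactly as in PointsTo and PointsFrom.
Points : ∀ {V : Set} → Bool → Maybe Bool → V → V → V → Set
Points true  x t h v = (x ≡ just true × h ≡ v) ⊎ (x ≡ just false × t ≡ v)
Points false x t h v = (x ≡ just true × t ≡ v) ⊎ (x ≡ just false × h ≡ v)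

points-head : ∀ {V : Set} {b x} {t h v : V} → Points b x t h v → t ≢ v → x ≡ just b
points-head {b = true}  (inj₁ (x≡ , _)) _   = x≡
points-head {b = true}  (inj₂ (_ , t≡)) t≢v = ⊥-elim (t≢v t≡)
points-head {b = false} (inj₁ (_ , t≡)) t≢v = ⊥-elim (t≢v t≡)
points-head {b = false} (inj₂ (x≡ , _)) _   = x≡

points-tail : ∀ {V : Set} {b x} {t h v : V} → Points b x t h v → h ≢ v → x ≡ just (not b)
points-tail {b = true}  (inj₁ (_ , h≡)) h≢v = ⊥-elim (h≢v h≡)
points-tail {b = true}  (inj₂ (x≡ , _)) _   = x≡
points-tail {b = false} (inj₁ (x≡ , _)) _   = x≡
points-tail {b = false} (inj₂ (_ , h≡)) h≢v = ⊥-elim (h≢v h≡)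

head-points : ∀ {V : Set} {b x} {t h v : V} → x ≡ just b → h ≡ v → Points b x t h v
head-points {b = true}  x≡ h≡ = inj₁ (x≡ , h≡)
head-points {b = false} x≡ h≡ = inj₂ (x≡ , h≡)

tail-points : ∀ {V : Set} {b x} {t h v : V} → x ≡ just (not b) → t ≡ v → Points b x t h v
tail-points {b = true}  x≡ t≡ = inj₂ (x≡ , t≡)
tail-points {b = false} x≡ t≡ = inj₁ (x≡ , t≡)

points-map : ∀ {A B : Set} {f : A → B} → Injective _≡_ _≡_ f → ∀ {b x} {t h v : Maybe A} →
             Points b x (Maybe.map f t) (Maybe.map f h) (Maybe.map f v) → Points b x t h v
points-map f-inj {true}  = Sum.map (map₂ (map-injective f-inj)) (map₂ (map-injective f-inj))
points-map f-inj {false} = Sum.map (map₂ (map-injective f-inj)) (map₂ (map-injective f-inj))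

map-points : ∀ {A B : Set} (f : A → B) {b x} {t h v : Maybe A} →
             Points b x t h v → Points b x (Maybe.map f t) (Maybe.map f h) (Maybe.map f v)
map-points f {true}  = Sum.map (map₂ (cong (Maybe.map f))) (map₂ (cong (Maybe.map f)))
map-points f {false} = Sum.map (map₂ (cong (Maybe.map f))) (map₂ (cong (Maybe.map f)))

cycHead-inject₁ : ∀ {K} (j : Fin K) → cycHead (inject₁ j) ≡ just j
cycHead-inject₁ {suc K} zero    = refl
cycHead-inject₁ {suc K} (suc j) = cong (Maybe.map suc) (cycHead-inject₁ j)

cycHead-fromℕ : ∀ K → cycHead (fromℕ K) ≡ nothing
cycHead-fromℕ zero    = refl
cycHead-fromℕ (suc K) = cong (Maybe.map suc) (cycHead-fromℕ K)

cycHead-just : ∀ {K} (i : Fin (suc K)) {j} → cycHead i ≡ just j → i ≡ inject₁ j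
cycHead-just {suc K} zero    refl = refl
cycHead-just {suc K} (suc i) e with cycHead i in eq
cycHead-just {suc K} (suc i) refl | just _ = cong suc (cycHead-just i eq)

cycHead-nothing : ∀ {K} (i : Fin (suc K)) → cycHead i ≡ nothing → i ≡ fromℕ K
cycHead-nothing {zero}  zero    _ = refl
cycHead-nothing {suc K} (suc i) e with cycHead i in eq
... | nothing = cong suc (cycHead-nothing i eq)

cycTail-just : ∀ {K} (i : Fin (suc K)) {j} → cycTail i ≡ just j → i ≡ suc j
cycTail-just (suc i) refl = refl

cycTail-nothing : ∀ {K} (i : Fin (suc K)) → cycTail i ≡ nothing → i ≡ zero
cycTail-nothing zero refl = refl

-- Sink (b = true) and Source (b = false) within a single cycle.
Focus : ∀ {K} → Bool → Marking (suc K) → Maybe (Fin K) → Set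
Focus b q v = ∀ i → cycTail i ≡ v ⊎ cycHead i ≡ v → Points b (q i) (cycTail i) (cycHead i) v

focus⇒interior : ∀ {K} {q : Marking (suc K)} {b j} → Focus b q (just j) →
                 q (inject₁ j) ≡ just b × q (suc j) ≡ just (not b)
focus⇒interior {j = j} f =
  points-head (f _ (inj₂ (cycHead-inject₁ j))) (suc≢inject₁ ∘ sym ∘ cycTail-just _) ,
  points-tail (f _ (inj₁ refl)) (suc≢inject₁ ∘ cycHead-just _)

interior⇒focus : ∀ {K} {q : Marking (suc K)} {b j} → q (inject₁ j) ≡ just b → q (suc j) ≡ just (not b) →
                 Focus b q (just j)
interior⇒focus ql qr i (inj₁ t≡) with refl ← cycTail-just i t≡ = tail-points qr t≡
interior⇒focus ql qr i (inj₂ h≡) with refl ← cycHead-just i h≡ = head-points ql h≡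

focus⇒hubEdges : ∀ {K} {q : Marking (suc (suc K))} {b} → Focus b q nothing → HubEdges b q
focus⇒hubEdges {K} f =
  points-tail (f zero (inj₁ refl)) (λ ()) , points-head (f (fromℕ (suc K)) (inj₂ (cycHead-fromℕ (suc K)))) (λ ())

hubEdges⇒focus : ∀ {K} {q : Marking (suc (suc K))} {b} → HubEdges b q → Focus b q nothing
hubEdges⇒focus (q0 , qL) i (inj₁ t≡) with refl ← cycTail-nothing i t≡ = tail-points q0 t≡
hubEdges⇒focus (q0 , qL) i (inj₂ h≡) with refl ← cycHead-nothing i h≡ = head-points qL h≡

coherentAt⇒¬focus : ∀ {K} {q : Marking (suc K)} {b j} → CoherentAt q j → ¬ Focus b q (just j)
coherentAt⇒¬focus c f with ql , qr ← focus⇒interior f = not-¬ refl (c ql qr)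

¬focus⇒coherentAt : ∀ {K} {q : Marking (suc K)} {j} → (∀ b → ¬ Focus b q (just j)) → CoherentAt q j
¬focus⇒coherentAt ¬f {s} {t} ql qr with s ≟ᵇ t
... | yes s≡t = s≡t
... | no s≢t  = ⊥-elim (¬f s (interior⇒focus ql (trans qr (cong just (¬-not (s≢t ∘ sym))))))

module TwoCycles (K L : ℕ) where
  open Game (twoCyclesS (suc K) (suc L))
  open Board (twoCyclesS (suc K) (suc L)) using (Vtx; tail; head; _≟E_)

  left : Position → Marking (suc (suc K))
  left p i = p (inj₁ i)

  right : Position → Marking (suc (suc L))
  right p j = p (inj₂ j)

  BoardFocus : Bool → Position → Vtx → Set
  BoardFocus b p v = ∀ e → Incident e v → Points b (p e) (tail e) (head e) v

  NoSinkSource : Position → Set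
  NoSinkSource p = ∀ v → ¬ Sink p v × ¬ Source p v

  boardFocus⇒focus-left : ∀ {p b v} → BoardFocus b p (Maybe.map inj₁ v) → Focus b (left p) v
  boardFocus⇒focus-left f i touch =
    points-map inj₁-injective (f (inj₁ i) (Sum.map (cong (Maybe.map inj₁)) (cong (Maybe.map inj₁)) touch))

  boardFocus⇒focus-right : ∀ {p b v} → BoardFocus b p (Maybe.map inj₂ v) → Focus b (right p) v
  boardFocus⇒focus-right f i touch =
    points-map inj₂-injective (f (inj₂ i) (Sum.map (cong (Maybe.map inj₂)) (cong (Maybe.map inj₂)) touch))

  focus⇒boardFocus-hub : ∀ {p b} → Focus b (left p) nothing → Focus b (right p) nothing → BoardFocus b p nothing
  focus⇒boardFocus-hub f₁ f₂ (inj₁ i) inc =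
    map-points inj₁ (f₁ i (Sum.map (map-injective inj₁-injective) (map-injective inj₁-injective) inc))
  focus⇒boardFocus-hub f₁ f₂ (inj₂ i) inc =
    map-points inj₂ (f₂ i (Sum.map (map-injective inj₂-injective) (map-injective inj₂-injective) inc))

  focus⇒boardFocus-left : ∀ {p b j} → Focus b (left p) (just j) → BoardFocus b p (just (inj₁ j))
  focus⇒boardFocus-left f (inj₁ i) inc =
    map-points inj₁ (f i (Sum.map (map-injective inj₁-injective) (map-injective inj₁-injective) inc))
  focus⇒boardFocus-left f (inj₂ i) inc = ⊥-elim ([ elsewhere (cycTail i) , elsewhere (cycHead i) ]′ inc)
    where
    elsewhere : ∀ x {j} → Maybe.map inj₂ x ≢ just (inj₁ j)
    elsewhere (just _) ()

  focus⇒boardFocus-right : ∀ {p b j} → Focus b (right p) (just j) → BoardFocus b p (just (inj₂ j))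
  focus⇒boardFocus-right f (inj₂ i) inc =
    map-points inj₂ (f i (Sum.map (map-injective inj₂-injective) (map-injective inj₂-injective) inc))
  focus⇒boardFocus-right f (inj₁ i) inc = ⊥-elim ([ elsewhere (cycTail i) , elsewhere (cycHead i) ]′ inc)
    where
    elsewhere : ∀ x {j} → Maybe.map inj₁ x ≢ just (inj₂ j)
    elsewhere (just _) ()

  safe⇒noSinkSource : ∀ p → Safe (left p) (right p) → NoSinkSource p
  safe⇒noSinkSource p safe v = ¬focus true v , ¬focus false v
    where
    open Safe safe
    ¬focus : ∀ b v → ¬ BoardFocus b p v
    ¬focus b nothing         f = hubSafe b ( focus⇒hubEdges (boardFocus⇒focus-left {v = nothing} f)
                                           , focus⇒hubEdges (boardFocus⇒focus-right {v = nothing} f))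
    ¬focus b (just (inj₁ j)) f = coherentAt⇒¬focus (coherent₁ j) (boardFocus⇒focus-left {v = just j} f)
    ¬focus b (just (inj₂ j)) f = coherentAt⇒¬focus (coherent₂ j) (boardFocus⇒focus-right {v = just j} f)

  noSinkSource⇒safe : ∀ p → NoSinkSource p → Safe (left p) (right p)
  noSinkSource⇒safe p noSS = record
    { coherent₁ = λ j → ¬focus⇒coherentAt λ b → ¬focus b _ ∘ focus⇒boardFocus-left
    ; coherent₂ = λ j → ¬focus⇒coherentAt λ b → ¬focus b _ ∘ focus⇒boardFocus-right
    ; hubSafe   = λ b (h₁ , h₂) →
                    ¬focus b nothing (focus⇒boardFocus-hub (hubEdges⇒focus h₁) (hubEdges⇒focus h₂))
    }
    where
    ¬focus : ∀ b v → ¬ BoardFocus b p v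
    ¬focus true  v = proj₁ (noSS v)
    ¬focus false v = proj₂ (noSS v)

  cycleCell⇒cyclic : ∀ p → HasCycleCell p → Cyclic (left p) ⊎ Cyclic (right p)
  cycleCell⇒cyclic p (true  , inj₁ a) = inj₁ (true  , tabulate⁻ (map⁻ a))
  cycleCell⇒cyclic p (true  , inj₂ a) = inj₁ (false , tabulate⁻ (map⁻ a))
  cycleCell⇒cyclic p (false , inj₁ a) = inj₂ (true  , tabulate⁻ (map⁻ a))
  cycleCell⇒cyclic p (false , inj₂ a) = inj₂ (false , tabulate⁻ (map⁻ a))

  cyclic⇒cycleCell : ∀ p → Cyclic (left p) ⊎ Cyclic (right p) → HasCycleCell p
  cyclic⇒cycleCell p (inj₁ (true  , f)) = true  , inj₁ (map⁺ (tabulate⁺ f))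
  cyclic⇒cycleCell p (inj₁ (false , f)) = true  , inj₂ (map⁺ (tabulate⁺ f))
  cyclic⇒cycleCell p (inj₂ (true  , f)) = false , inj₁ (map⁺ (tabulate⁺ f))
  cyclic⇒cycleCell p (inj₂ (false , f)) = false , inj₂ (map⁺ (tabulate⁺ f))

  ¬cyclic⇒¬cycleCell : ∀ p → ¬ Cyclic (left p) → ¬ Cyclic (right p) → ¬ HasCycleCell p
  ¬cyclic⇒¬cycleCell p ¬c₁ ¬c₂ = [ ¬c₁ , ¬c₂ ]′ ∘ cycleCell⇒cyclic p

  mark-here : ∀ p e d → mark p e d e ≡ just d
  mark-here p e d with e ≟E e
  ... | yes _   = refl
  ... | no e≢e = ⊥-elim (e≢e refl)

  mark-elsewhere : ∀ p e d {e′} → e′ ≢ e → mark p e d e′ ≡ p e′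
  mark-elsewhere p e d {e′} e′≢e with e′ ≟E e
  ... | yes e′≡e = ⊥-elim (e′≢e e′≡e)
  ... | no _     = refl

  mark-left : ∀ p i d → Marked (left p) i d (left (mark p (inj₁ i) d))
  mark-left p i d = mark-here p (inj₁ i) d , λ k k≢i → mark-elsewhere p (inj₁ i) d (k≢i ∘ inj₁-injective)

  mark-right : ∀ p i d → Marked (right p) i d (right (mark p (inj₂ i) d))
  mark-right p i d = mark-here p (inj₂ i) d , λ k k≢i → mark-elsewhere p (inj₂ i) d (k≢i ∘ inj₂-injective)

  mark-left-right : ∀ p i d → right (mark p (inj₁ i) d) ≗ right p
  mark-left-right p i d k = mark-elsewhere p (inj₁ i) d λ ()

  mark-right-left : ∀ p i d → left (mark p (inj₂ i) d) ≗ left p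
  mark-right-left p i d k = mark-elsewhere p (inj₂ i) d λ ()

  openBoardEdges : Position → ℕ
  openBoardEdges p = openEdges (left p) + openEdges (right p)

  openBoardEdges-mark : ∀ p e d → p e ≡ nothing → openBoardEdges (mark p e d) < openBoardEdges p
  openBoardEdges-mark p (inj₁ i) d pe =
    ℕ.+-mono-<-≤ (openEdges-mark pe (mark-left p i d)) (ℕ.≤-reflexive (openEdges-resp (mark-left-right p i d)))
  openBoardEdges-mark p (inj₂ i) d pe =
    ℕ.+-mono-≤-< (ℕ.≤-reflexive (openEdges-resp (mark-right-left p i d))) (openEdges-mark pe (mark-right p i d))

  module Play (A₁ : Axis (suc K)) (A₂ : Axis (suc L)) where
    open Responses using (respond)

    LosingBelow : ℕ → Set
    LosingBelow n = ∀ p → openBoardEdges p < n → ¬ HasCycleCell p → Safe (left p) (right p) →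
                    Invariant A₁ A₂ (left p) (right p) → Lose p

    settle : ∀ {n} → LosingBelow n → ∀ p → openBoardEdges p < n → Outcome A₁ A₂ (left p) (right p) →
             HasCycleCell p ⊎ Lose p
    settle losing p _ (_ , inj₁ c) = inj₁ (cyclic⇒cycleCell p c)
    settle losing p p<n (safe , inj₂ inv) with cyclic? (left p) | cyclic? (right p)
    ... | yes c  | _      = inj₁ (cyclic⇒cycleCell p (inj₁ c))
    ... | no _   | yes c  = inj₁ (cyclic⇒cycleCell p (inj₂ c))
    ... | no ¬c₁ | no ¬c₂ = inj₂ (losing p p<n (¬cyclic⇒¬cycleCell p ¬c₁ ¬c₂) safe inv)

    play : ∀ {n p q₁ q₂} → LosingBelow n → Reply A₁ A₂ q₁ q₂ → q₁ ≗ left p → q₂ ≗ right p →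
           openBoardEdges p < suc n → Win p
    play {p = p} losing (first j d qj continue) q₁≗ q₂≗ p<n =
      win (inj₁ j) d (pj , safe⇒noSinkSource _ (proj₁ outcome))
          (settle losing _ (ℕ.<-≤-trans (openBoardEdges-mark p (inj₁ j) d pj) (ℕ.≤-pred p<n)) outcome)
      where
      pj : p (inj₁ j) ≡ nothing
      pj = trans (sym (q₁≗ j)) qj
      outcome : Outcome A₁ A₂ (left (mark p (inj₁ j) d)) (right (mark p (inj₁ j) d))
      outcome = continue (marked-resp q₁≗ (mark-left p j d)) (λ k → trans (mark-left-right p j d k) (sym (q₂≗ k)))
    play {p = p} losing (second j d qj continue) q₁≗ q₂≗ p<n =
      win (inj₂ j) d (pj , safe⇒noSinkSource _ (proj₁ outcome))
          (settle losing _ (ℕ.<-≤-trans (openBoardEdges-mark p (inj₂ j) d pj) (ℕ.≤-pred p<n)) outcome)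
      where
      pj : p (inj₂ j) ≡ nothing
      pj = trans (sym (q₂≗ j)) qj
      outcome : Outcome A₁ A₂ (left (mark p (inj₂ j) d)) (right (mark p (inj₂ j) d))
      outcome = continue (λ k → trans (mark-right-left p j d k) (sym (q₁≗ k))) (marked-resp q₂≗ (mark-right p j d))

    lose-from : ∀ n → LosingBelow n
    lose-from (suc n) p p<n ¬cyc safe inv = lose answer
      where
      open Safe safe
      fewer : ∀ e d → p e ≡ nothing → openBoardEdges (mark p e d) < suc n
      fewer e d pe = ℕ.<-trans (openBoardEdges-mark p e d pe) p<n

      answer : ∀ e d → Legal p e d → ¬ HasCycleCell (mark p e d) × Win (mark p e d)
      answer (inj₁ i) d (pe , noSS)
        with ¬c₁ , reply ← respond A₁ A₂ inv coherent₂ pe (mark-left p i d)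
                                   (Safe.coherent₁ (noSinkSource⇒safe _ noSS)) =
        ¬cyclic⇒¬cycleCell _ ¬c₁ (¬cyc ∘ cyclic⇒cycleCell p ∘ inj₂ ∘ cyclic-resp (mark-left-right p i d)) ,
        play (lose-from n) reply (λ _ → refl) (sym ∘ mark-left-right p i d) (fewer (inj₁ i) d pe)
      answer (inj₂ i) d (pe , noSS)
        with ¬c₂ , reply ← respond A₂ A₁ (invariant-swap inv) coherent₁ pe (mark-right p i d)
                                   (Safe.coherent₂ (noSinkSource⇒safe _ noSS)) =
        ¬cyclic⇒¬cycleCell _ (¬cyc ∘ cyclic⇒cycleCell p ∘ inj₁ ∘ cyclic-resp (mark-right-left p i d)) ¬c₂ ,
        play (lose-from n) (reply-swap reply) (sym ∘ mark-right-left p i d) (λ _ → refl) (fewer (inj₂ i) d pe)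

    player2Wins : Lose empty
    player2Wins = lose-from (suc (openBoardEdges empty)) empty (ℕ.n<1+n _)
      (¬cyclic⇒¬cycleCell empty (unmarked⇒¬cyclic {i = zero} refl) (unmarked⇒¬cyclic {i = zero} refl))
      (record { coherent₁ = λ _ → λ () ; coherent₂ = λ _ → λ () ; hubSafe = λ { _ ((() , _) , _) } })
      (inj₁ record { symmetric₁ = λ _ → refl ; symmetric₂ = λ _ → refl
                   ; mids = open-mids refl refl (unthreatened A₁) (unthreatened A₂) })
      where
      unthreatened : ∀ {M} (A : Axis (suc M)) → Unthreatened A (λ _ → nothing)
      unthreatened A x f with () ← f zero (near-hub≢mid A zero (s≤s z≤n)) (near-hub≢mid A zero (s≤s z≤n))

proposition3p2 : (m n : ℕ) → 3 < m → 3 < n → Odd m → Odd n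
    → Player2Wins (twoCycles m n)
proposition3p2 _ _ _ _ (suc (suc a) , refl) (suc (suc b) , refl) =
  TwoCycles.Play.player2Wins _ _ (oddAxis (2 + a) (s≤s (s≤s z≤n))) (oddAxis (2 + b) (s≤s (s≤s z≤n)))
proposition3p2 _ _ (s≤s ()) _ (zero , refl) _
proposition3p2 _ _ (s≤s (s≤s (s≤s ()))) _ (suc zero , refl) _
proposition3p2 _ _ _ (s≤s ()) (suc (suc _) , refl) (zero , refl)
proposition3p2 _ _ _ (s≤s (s≤s (s≤s ()))) (suc (suc _) , refl) (suc zero , refl)
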